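{- Let $\pi\in\mathbb{Z}^n$. The map $(\lambda,\mu)\mapsto\mu-\lambda$ is a bijection from $S_\pi$ to $C_\pi$ with inverse $\delta\mapsto(\tfrac{\pi-\delta}{2},\tfrac{\pi+\delta}{2})$, and it is an isomorphism of preorders: for $(\lambda,\mu),(\lambda',\mu')\in S_\pi$, we have $(\lambda',\mu')\sqsubseteq(\lambda,\mu)$ if and only if $\mu'-\lambda'\preceq\mu-\lambda$.
   Context: For $x,y\in\mathbb{Z}^n$, $\Pi(x,y)=\{z\in\mathbb{Z}^n:\min(x_i-x_j,y_i-y_j)\le z_i-z_j\le\max(x_i-x_j,y_i-y_j)\ \forall\,1\le i<j\le n\}$. $S_\pi$ is the set of ordered pairs $(\lambda,\mu)$ of vectors in $\mathbb{Z}^n$ (not necessarily dominant) with $\lambda+\mu=\pi$, preordered by $(\lambda',\mu')\sqsubseteq(\lambda,\mu)$ iff $\Pi(\lambda',\mu')\subseteq\Pi(\lambda,\mu)$. $C_\pi$ is the set of $\delta\in\mathbb{Z}^n$ with $\delta_i\equiv\pi_i\bmod2$ for all $i$, preordered by $\delta'\preceq\delta$ iff $|\delta'_i-\delta'_j|\le|\delta_i-\delta_j|$ for all $1\le i<j\le n$. -}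

module Defs where

open import Data.Nat using (ℕ)
open import Data.Fin using (Fin; _<_)
open import Data.Integer using (ℤ; +_; _+_; _-_; _≤_; ∣_∣; _⊔_; _⊓_)
open import Data.Integer.DivMod using (_/_)
open import Data.Integer.Divisibility using (_∣_)
open import Data.Product using (_×_; _,_)
open import Relation.Binary.PropositionalEquality using (_≡_)

Vecℤ : ℕ → Set
Vecℤ n = Fin n → ℤ

_⊕_ : ∀ {n} → Vecℤ n → Vecℤ n → Vecℤ n
(x ⊕ y) i = x i + y i

_⊖_ : ∀ {n} → Vecℤ n → Vecℤ n → Vecℤ n
(x ⊖ y) i = x i - y i

-- halving (exact whenever the argument is even)
half : ∀ {n} → Vecℤ n → Vecℤ n
half x i = x i / (+ 2)

_≗ᵥ_ : ∀ {n} → Vecℤ n → Vecℤ n → Set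
x ≗ᵥ y = ∀ i → x i ≡ y i

Π : ∀ {n} → Vecℤ n → Vecℤ n → Vecℤ n → Set
Π x y z = ∀ i j → i < j →
  ((x i - x j) ⊓ (y i - y j) ≤ z i - z j) × (z i - z j ≤ (x i - x j) ⊔ (y i - y j))

InS : ∀ {n} → Vecℤ n → Vecℤ n → Vecℤ n → Set
InS π l m = (l ⊕ m) ≗ᵥ π

_,_⊑_,_ : ∀ {n} → Vecℤ n → Vecℤ n → Vecℤ n → Vecℤ n → Set
l' , m' ⊑ l , m = ∀ z → Π l' m' z → Π l m z

InC : ∀ {n} → Vecℤ n → Vecℤ n → Set
InC π δ = ∀ i → (+ 2) ∣ (δ i - π i)

_⪯_ : ∀ {n} → Vecℤ n → Vecℤ n → Set
δ' ⪯ δ = ∀ i j → i < j → ∣ δ' i - δ' j ∣ Data.Nat.≤ ∣ δ i - δ j ∣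

-- For i < j write a = λᵢ - λⱼ and b = μᵢ - μⱼ. The condition Π(λ,μ) puts on
-- zᵢ - zⱼ is the interval [a ⊓ b, a ⊔ b], whose centre (a + b)/2 = (πᵢ - πⱼ)/2
-- is the same for every pair in S_π and whose length is |b - a| = |δᵢ - δⱼ|.
-- Intervals with a common centre are nested exactly when their lengths
-- compare; conversely, since λ' and μ' themselves lie in Π(λ',μ'), the
-- inclusion Π(λ',μ') ⊆ Π(λ,μ) puts both endpoints of each interval of
-- (λ',μ') into the corresponding interval of (λ,μ), so their distance
-- |b' - a'| is at most its length |b - a|. The bijection is
-- coordinatewise: λᵢ + μᵢ = πᵢ and μᵢ - λᵢ = δᵢ are solvable in ℤ exactly
-- when δᵢ ≡ πᵢ mod 2.
{-# OPTIONS --safe #-}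
module Submission where

open import Defs
open import Data.Nat using (ℕ)
open import Data.Product using (_×_; _,_; ∃₂; proj₁; proj₂)
open import Function.Bundles using (_⇔_; mk⇔)
open import Function.Base using (_∘_)
import Data.Nat as ℕ
import Data.Nat.DivMod as ℕ
open import Data.Integer
  using (ℤ; +_; -[1+_]; +≤+; _+_; _-_; -_; _*_; _≤_; ∣_∣; _⊔_; _⊓_; _/ℕ_)
open import Data.Integer.Properties
open import Data.Integer.DivMod using (_/_; div-pos-is-/ℕ)
open import Data.Integer.Divisibility using (_∣_)
open import Data.Integer.Divisibility.Signed using (divides; ∣ᵤ⇒∣; ∣⇒∣ᵤ)
open import Data.Integer.Tactic.RingSolver using (solve-∀)
open import Data.Sum using (inj₁; inj₂)
open import Relation.Binary.PropositionalEquality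
  using (_≡_; refl; sym; trans; cong; cong₂; subst₂; module ≡-Reasoning)

i*n/ℕn≡i : ∀ i n .{{_ : ℕ.NonZero n}} → (i * + n) /ℕ n ≡ i
i*n/ℕn≡i (+ m) n = trans (cong (_/ℕ n) (sym (pos-* m n))) (cong +_ (ℕ.m*n/n≡m m n))
-- -[1+ m ] * + n is the negative numeral - (1 + m) · n, and _/ℕ_ on a negative
-- numeral branches on its remainder, which is 0 here.
i*n/ℕn≡i -[1+ m ] n@(ℕ.suc _) with ℕ.suc m ℕ.* n ℕ.% n | ℕ.m*n%n≡0 (ℕ.suc m) n
... | .0 | refl = cong (-_ ∘ +_) (ℕ.m*n/n≡m (ℕ.suc m) n)

i*n/n≡i : ∀ i n .{{_ : ℕ.NonZero n}} → (i * + n) / + n ≡ i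
i*n/n≡i i n = trans (div-pos-is-/ℕ (i * + n) n) (i*n/ℕn≡i i n)

2∣difference-minus-sum : ∀ l m {p} → l + m ≡ p → + 2 ∣ (m - l) - p
2∣difference-minus-sum l m refl = ∣⇒∣ᵤ (divides (- l) (ring l m))
  where
  ring : ∀ l m → (m - l) - (l + m) ≡ (- l) * + 2
  ring = solve-∀

halve-sum-difference : ∀ l m {p δ} → l + m ≡ p → m - l ≡ δ →
                       ((p - δ) / + 2 ≡ l) × ((p + δ) / + 2 ≡ m)
halve-sum-difference l m refl refl =
    trans (cong (_/ + 2) (ring₁ l m)) (i*n/n≡i l 2)
  , trans (cong (_/ + 2) (ring₂ l m)) (i*n/n≡i m 2)
  where
  ring₁ : ∀ l m → (l + m) - (m - l) ≡ l * + 2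
  ring₁ = solve-∀
  ring₂ : ∀ l m → (l + m) + (m - l) ≡ m * + 2
  ring₂ = solve-∀

same-parity⇒sum-and-difference : ∀ {p δ} → + 2 ∣ δ - p →
                                ∃₂ λ l m → (l + m ≡ p) × (m - l ≡ δ)
same-parity⇒sum-and-difference {p} {δ} 2∣δ-p with ∣ᵤ⇒∣ 2∣δ-p
... | divides k δ-p≡2k = - k , p + k , ring₁ p k , m-l≡δ
  where
  ring₁ : ∀ p k → - k + (p + k) ≡ p
  ring₁ = solve-∀
  ring₂ : ∀ p k → (p + k) - (- k) ≡ p + k * + 2
  ring₂ = solve-∀
  ring₃ : ∀ p δ → p + (δ - p) ≡ δ
  ring₃ = solve-∀
  open ≡-Reasoning
  m-l≡δ : (p + k) - (- k) ≡ δ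
  m-l≡δ = begin
    (p + k) - (- k) ≡⟨ ring₂ p k ⟩
    p + k * + 2     ≡⟨ cong (_+_ p) δ-p≡2k ⟨
    p + (δ - p)     ≡⟨ ring₃ p δ ⟩
    δ               ∎

halves-of-same-parity : ∀ {p δ} → + 2 ∣ δ - p →
                        ((p - δ) / + 2 + (p + δ) / + 2 ≡ p)
                        × ((p + δ) / + 2 - (p - δ) / + 2 ≡ δ)
halves-of-same-parity 2∣δ-p with same-parity⇒sum-and-difference 2∣δ-p
... | l , m , l+m≡p , m-l≡δ with halve-sum-difference l m l+m≡p m-l≡δ
...   | halfˡ≡l , halfʳ≡m =
          trans (cong₂ _+_ halfˡ≡l halfʳ≡m) l+m≡p
        , trans (cong₂ _-_ halfʳ≡m halfˡ≡l) m-l≡δ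

infix 4 _∈⟦_,_⟧

_∈⟦_,_⟧ : ℤ → ℤ → ℤ → Set
z ∈⟦ a , b ⟧ = (a ⊓ b ≤ z) × (z ≤ a ⊔ b)

left∈⟦_,_⟧ : ∀ a b → a ∈⟦ a , b ⟧
left∈⟦ a , b ⟧ = i⊓j≤i a b , i≤i⊔j a b

right∈⟦_,_⟧ : ∀ a b → b ∈⟦ a , b ⟧
right∈⟦ a , b ⟧ = i⊓j≤j a b , i≤j⊔i a b

i⊓j+i⊔j≡i+j : ∀ i j → i ⊓ j + (i ⊔ j) ≡ i + j
i⊓j+i⊔j≡i+j i j with ≤-total i j
... | inj₁ i≤j = cong₂ _+_ (i≤j⇒i⊓j≡i i≤j) (i≤j⇒i⊔j≡j i≤j)
... | inj₂ j≤i = trans (cong₂ _+_ (i≥j⇒i⊓j≡j j≤i) (i≥j⇒i⊔j≡i j≤i)) (+-comm j i)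

∣j-i∣≡i⊔j-i⊓j : ∀ i j → + ∣ j - i ∣ ≡ (i ⊔ j) - (i ⊓ j)
∣j-i∣≡i⊔j-i⊓j i j with ≤-total i j
... | inj₁ i≤j = trans (cong +_ (∣i-j∣≡∣j-i∣ j i))
  (trans (∣-∣-≤ i≤j) (sym (cong₂ _-_ (i≤j⇒i⊔j≡j i≤j) (i≤j⇒i⊓j≡i i≤j))))
... | inj₂ j≤i =
  trans (∣-∣-≤ j≤i) (sym (cong₂ _-_ (i≥j⇒i⊔j≡i j≤i) (i≥j⇒i⊓j≡j j≤i)))

distance-within : ∀ {lo hi x y} → lo ≤ x → x ≤ hi → lo ≤ y → y ≤ hi →
                  + ∣ y - x ∣ ≤ hi - lo
distance-within {x = x} {y} lo≤x x≤hi lo≤y y≤hi with ≤-total x y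
... | inj₁ x≤y = ≤-trans (≤-reflexive (trans (cong +_ (∣i-j∣≡∣j-i∣ y x)) (∣-∣-≤ x≤y)))
                         (+-mono-≤ y≤hi (neg-mono-≤ lo≤x))
... | inj₂ y≤x = ≤-trans (≤-reflexive (∣-∣-≤ y≤x)) (+-mono-≤ x≤hi (neg-mono-≤ lo≤y))

∈⟦⟧-distance : ∀ {a b x y} → x ∈⟦ a , b ⟧ → y ∈⟦ a , b ⟧ → ∣ y - x ∣ ℕ.≤ ∣ b - a ∣
∈⟦⟧-distance {a} {b} (lo≤x , x≤hi) (lo≤y , y≤hi) = drop‿+≤+
  (≤-trans (distance-within lo≤x x≤hi lo≤y y≤hi) (≤-reflexive (sym (∣j-i∣≡i⊔j-i⊓j a b))))

same-centre-nested : ∀ {lo hi lo′ hi′} → lo + hi ≡ lo′ + hi′ → hi′ - lo′ ≤ hi - lo →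
                     (lo ≤ lo′) × (hi′ ≤ hi)
same-centre-nested {lo} {hi} {lo′} {hi′} s≡s′ w′≤w =
    *-cancelʳ-≤-pos lo lo′ (+ 2) (begin
      lo * + 2                   ≡⟨ lower lo hi ⟩
      (lo + hi) - (hi - lo)      ≤⟨ +-monoʳ-≤ (lo + hi) (neg-mono-≤ w′≤w) ⟩
      (lo + hi) - (hi′ - lo′)    ≡⟨ cong (_- (hi′ - lo′)) s≡s′ ⟩
      (lo′ + hi′) - (hi′ - lo′)  ≡⟨ lower lo′ hi′ ⟨
      lo′ * + 2                  ∎)
  , *-cancelʳ-≤-pos hi′ hi (+ 2) (begin
      hi′ * + 2                  ≡⟨ upper lo′ hi′ ⟩
      (lo′ + hi′) + (hi′ - lo′)  ≡⟨ cong (_+ (hi′ - lo′)) s≡s′ ⟨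
      (lo + hi) + (hi′ - lo′)    ≤⟨ +-monoʳ-≤ (lo + hi) w′≤w ⟩
      (lo + hi) + (hi - lo)      ≡⟨ upper lo hi ⟨
      hi * + 2                   ∎)
  where
  open ≤-Reasoning
  lower : ∀ lo hi → lo * + 2 ≡ (lo + hi) - (hi - lo)
  lower = solve-∀
  upper : ∀ lo hi → hi * + 2 ≡ (lo + hi) + (hi - lo)
  upper = solve-∀

∈⟦⟧-nested : ∀ {a b a′ b′ z} → a + b ≡ a′ + b′ → ∣ b′ - a′ ∣ ℕ.≤ ∣ b - a ∣ →
             z ∈⟦ a′ , b′ ⟧ → z ∈⟦ a , b ⟧
∈⟦⟧-nested {a} {b} {a′} {b′} s≡s′ w′≤w (lo′≤z , z≤hi′)
  with same-centre-nested
         (trans (i⊓j+i⊔j≡i+j a b) (trans s≡s′ (sym (i⊓j+i⊔j≡i+j a′ b′))))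
         (subst₂ _≤_ (∣j-i∣≡i⊔j-i⊓j a′ b′) (∣j-i∣≡i⊔j-i⊓j a b) (+≤+ w′≤w))
... | lo≤lo′ , hi′≤hi = ≤-trans lo≤lo′ lo′≤z , ≤-trans z≤hi′ hi′≤hi

Π-left : ∀ {n} (x y : Vecℤ n) → Π x y x
Π-left x y i j _ = left∈⟦ x i - x j , y i - y j ⟧

Π-right : ∀ {n} (x y : Vecℤ n) → Π x y y
Π-right x y i j _ = right∈⟦ x i - x j , y i - y j ⟧

InS⇒differences-sum : ∀ {n} {π : Vecℤ n} (l m : Vecℤ n) → InS π l m →
                      ∀ i j → (l i - l j) + (m i - m j) ≡ π i - π j
InS⇒differences-sum l m l+m≗π i j =
  trans (ring (l i) (l j) (m i) (m j)) (cong₂ _-_ (l+m≗π i) (l+m≗π j))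
  where
  ring : ∀ a b c d → (a - b) + (c - d) ≡ (a + c) - (b + d)
  ring = solve-∀

∣⊖-difference∣ : ∀ {n} (l m : Vecℤ n) i j →
                 ∣ (m ⊖ l) i - (m ⊖ l) j ∣ ≡ ∣ (m i - m j) - (l i - l j) ∣
∣⊖-difference∣ l m i j = cong ∣_∣ (ring (l i) (l j) (m i) (m j))
  where
  ring : ∀ a b c d → (c - a) - (d - b) ≡ (c - d) - (a - b)
  ring = solve-∀

⊑⇔⪯ : ∀ {n} {π : Vecℤ n} (l m l′ m′ : Vecℤ n) → InS π l m → InS π l′ m′ →
      (l′ , m′ ⊑ l , m) ⇔ ((m′ ⊖ l′) ⪯ (m ⊖ l))
⊑⇔⪯ l m l′ m′ l+m≗π l′+m′≗π = mk⇔ ⊑⇒⪯ ⪯⇒⊑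
  where
  ⊑⇒⪯ : l′ , m′ ⊑ l , m → (m′ ⊖ l′) ⪯ (m ⊖ l)
  ⊑⇒⪯ Π′⊆Π i j i<j =
    subst₂ ℕ._≤_ (sym (∣⊖-difference∣ l′ m′ i j)) (sym (∣⊖-difference∣ l m i j))
      (∈⟦⟧-distance (Π′⊆Π l′ (Π-left l′ m′) i j i<j) (Π′⊆Π m′ (Π-right l′ m′) i j i<j))
  ⪯⇒⊑ : (m′ ⊖ l′) ⪯ (m ⊖ l) → l′ , m′ ⊑ l , m
  ⪯⇒⊑ δ′⪯δ z z∈Π′ i j i<j =
    ∈⟦⟧-nested
      (trans (InS⇒differences-sum l m l+m≗π i j)
             (sym (InS⇒differences-sum l′ m′ l′+m′≗π i j)))
      (subst₂ ℕ._≤_ (∣⊖-difference∣ l′ m′ i j) (∣⊖-difference∣ l m i j) (δ′⪯δ i j i<j))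
      (z∈Π′ i j i<j)

mainTheorem12 : (n : ℕ) → (π : Vecℤ n) →
    -- the map (λ,μ) ↦ μ - λ sends S_π into C_π
    (∀ l m → InS π l m → InC π (m ⊖ l))
    -- the inverse δ ↦ ((π-δ)/2, (π+δ)/2) sends C_π into S_π
    × (∀ δ → InC π δ → InS π (half (π ⊖ δ)) (half (π ⊕ δ)))
    -- the two maps are mutually inverse
    × (∀ l m → InS π l m →
         (half (π ⊖ (m ⊖ l)) ≗ᵥ l) × (half (π ⊕ (m ⊖ l)) ≗ᵥ m))
    × (∀ δ → InC π δ → (half (π ⊕ δ) ⊖ half (π ⊖ δ)) ≗ᵥ δ)
    -- isomorphism of preorders
    × (∀ l m l' m' → InS π l m → InS π l' m' →
         ((l' , m' ⊑ l , m) ⇔ ((m' ⊖ l') ⪯ (m ⊖ l))))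
mainTheorem12 _ _ =
    (λ l m l+m≗π i → 2∣difference-minus-sum (l i) (m i) (l+m≗π i))
  , (λ δ 2∣δ-π i → proj₁ (halves-of-same-parity (2∣δ-π i)))
  , (λ l m l+m≗π →
        (λ i → proj₁ (halve-sum-difference (l i) (m i) (l+m≗π i) refl))
      , (λ i → proj₂ (halve-sum-difference (l i) (m i) (l+m≗π i) refl)))
  , (λ δ 2∣δ-π i → proj₂ (halves-of-same-parity (2∣δ-π i)))
  , ⊑⇔⪯
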